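{- $\mathrm{MITL}[F,P]\not\subseteq\mathrm{BMTL}[U,S]$: there is an MITL$[F,P]$ formula $\phi$ such that no BMTL$[U,S]$ formula $\psi$ satisfies $\mathcal{L}(\psi)=\mathcal{L}(\phi)$.
   Context: Fix a finite alphabet $\Sigma$. A timed word is $\rho=(\sigma_1,\tau_1)\cdots(\sigma_n,\tau_n)$, $n\ge1$, $\sigma_i\in\Sigma$, $\tau_i\in\mathbb{R}_{\ge0}$, $\tau_1=0$, $\tau_i\le\tau_{i+1}$. An interval is a convex subset of $\mathbb{R}_{\ge0}$ with endpoints non-negative integers or $\infty$ (finite ends open or closed); it is singular if of the form $[c,c]$, bounded if it does not extend to $\infty$. MTL$[U,S]$ formulas: $\phi::=a\mid\phi\wedge\phi\mid\neg\phi\mid\phi U_I\phi\mid\phi S_I\phi$ ($a\in\Sigma$, $I$ an interval), with strict semantics: $\rho,i\models\phi_1U_I\phi_2$ iff $\exists j>i$: $\rho,j\models\phi_2$, $\tau_j-\tau_i\in I$, $\forall i<k<j$: $\rho,k\models\phi_1$; $\rho,i\models\phi_1S_I\phi_2$ iff $\exists j<i$: $\rho,j\models\phi_2$, $\tau_i-\tau_j\in I$, $\forall j<k<i$: $\rho,k\models\phi_1$; $\rho,i\models a$ iff $\sigma_i=a$; Booleans as usual. $F_I\phi:=\top U_I\phi$, $P_I\phi:=\top S_I\phi$. $\mathcal{L}(\phi)=\{\rho:\rho,1\models\phi\}$. MITL$[U,S]$ allows only non-singular intervals, BMTL$[U,S]$ only bounded intervals; MITL$[F,P]$ is the fragment of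 MITL$[U,S]$ using only the modalities $F_I,P_I$. -}

module Defs where

open import Data.Nat using (ℕ; suc)
open import Data.Integer using (+_)
open import Data.Fin using (Fin; zero) renaming (_<_ to _<ᶠ_; _≤_ to _≤ᶠ_)
open import Data.Rational using (ℚ; 0ℚ; _/_; _-_; _≤_; _<_)
open import Data.Bool using (Bool; true; false)
open import Data.Product using (Σ; _×_)
open import Data.Empty using (⊥)
open import Data.Unit using (⊤)
open import Relation.Binary.PropositionalEquality using (_≡_)
open import Relation.Nullary using (¬_)

ℕ→ℚ : ℕ → ℚ
ℕ→ℚ n = (+ n) / 1

data Upper : Set where
  fin : ℕ → Bool → Upper   -- finite upper end point, Bool = closed?
  ∞   : Upper

record Interval : Set where
  constructor ⟨_,_,_⟩
  field
    lo       : ℕ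
    loClosed : Bool        -- true = closed, false = open
    hi       : Upper

open Interval public

_∈I_ : ℚ → Interval → Set
t ∈I ⟨ l , true  , u ⟩ = ℕ→ℚ l ≤ t × upperOK u
  where
  upperOK : Upper → Set
  upperOK (fin h true)  = t ≤ ℕ→ℚ h
  upperOK (fin h false) = t < ℕ→ℚ h
  upperOK ∞             = ⊤
t ∈I ⟨ l , false , u ⟩ = ℕ→ℚ l < t × upperOK u
  where
  upperOK : Upper → Set
  upperOK (fin h true)  = t ≤ ℕ→ℚ h
  upperOK (fin h false) = t < ℕ→ℚ h
  upperOK ∞             = ⊤

Singular : Interval → Set
Singular ⟨ l , true , fin h true ⟩ = l ≡ h
Singular _ = ⊥

Bounded : Interval → Set
Bounded ⟨ _ , _ , fin _ _ ⟩ = ⊤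
Bounded ⟨ _ , _ , ∞ ⟩ = ⊥

-- Timed words over alphabet Σ: positions Fin (suc n) (position 1 = zero).

record TimedWord (Σ' : Set) : Set where
  field
    len  : ℕ                          -- number of letters minus one
    sym  : Fin (suc len) → Σ'
    time : Fin (suc len) → ℚ
    time-zero : time zero ≡ 0ℚ
    time-mono : ∀ i j → i ≤ᶠ j → time i ≤ time j

open TimedWord public

data Form (Σ' : Set) : Set where
  atom : Σ' → Form Σ'
  _∧'_ : Form Σ' → Form Σ' → Form Σ'
  ¬'_  : Form Σ' → Form Σ'
  U[_] : Interval → Form Σ' → Form Σ' → Form Σ'   -- U[ I ] φ₁ φ₂ = φ₁ U_I φ₂
  S[_] : Interval → Form Σ' → Form Σ' → Form Σ'   -- S[ I ] φ₁ φ₂ = φ₁ S_I φ₂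

-- strict semantics
_,_⊨_ : {Σ' : Set} (ρ : TimedWord Σ') → Fin (suc (len ρ)) → Form Σ' → Set
ρ , i ⊨ atom a = sym ρ i ≡ a
ρ , i ⊨ (φ ∧' ψ) = (ρ , i ⊨ φ) × (ρ , i ⊨ ψ)
ρ , i ⊨ (¬' φ) = ¬ (ρ , i ⊨ φ)
ρ , i ⊨ U[ I ] φ₁ φ₂ =
  Σ (Fin (suc (len ρ))) λ j → (i <ᶠ j) × (ρ , j ⊨ φ₂) × ((time ρ j - time ρ i) ∈I I)
    × (∀ k → i <ᶠ k → k <ᶠ j → ρ , k ⊨ φ₁)
ρ , i ⊨ S[ I ] φ₁ φ₂ =
  Σ (Fin (suc (len ρ))) λ j → (j <ᶠ i) × (ρ , j ⊨ φ₂) × ((time ρ i - time ρ j) ∈I I)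
    × (∀ k → j <ᶠ k → k <ᶠ i → ρ , k ⊨ φ₁)

SameLanguage : {Σ' : Set} → Form Σ' → Form Σ' → Set
SameLanguage {Σ'} ψ φ = (ρ : TimedWord Σ') →
  ((ρ , zero ⊨ ψ) → (ρ , zero ⊨ φ)) × ((ρ , zero ⊨ φ) → (ρ , zero ⊨ ψ))

AllIntervals : {Σ' : Set} → (Interval → Set) → Form Σ' → Set
AllIntervals P (atom _) = ⊤
AllIntervals P (φ ∧' ψ) = AllIntervals P φ × AllIntervals P ψ
AllIntervals P (¬' φ) = AllIntervals P φ
AllIntervals P (U[ I ] φ ψ) = P I × AllIntervals P φ × AllIntervals P ψ
AllIntervals P (S[ I ] φ ψ) = P I × AllIntervals P φ × AllIntervals P ψ

IsBMTL : {Σ' : Set} → Form Σ' → Set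
IsBMTL = AllIntervals Bounded

data FPForm (Σ' : Set) : Set where
  atom : Σ' → FPForm Σ'
  _∧'_ : FPForm Σ' → FPForm Σ' → FPForm Σ'
  ¬'_  : FPForm Σ' → FPForm Σ'
  F[_] : Interval → FPForm Σ' → FPForm Σ'
  P[_] : Interval → FPForm Σ' → FPForm Σ'

-- ⊤ as a formula (needs some letter a; ⊤ := ¬(a ∧ ¬a))
top : {Σ' : Set} → Σ' → Form Σ'
top a = ¬' (atom a ∧' (¬' atom a))

toForm : {Σ' : Set} → Σ' → FPForm Σ' → Form Σ'
toForm a (atom b) = atom b
toForm a (φ ∧' ψ) = toForm a φ ∧' toForm a ψ
toForm a (¬' φ) = ¬' toForm a φ
toForm a (F[ I ] φ) = U[ I ] (top a) (toForm a φ)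
toForm a (P[ I ] φ) = S[ I ] (top a) (toForm a φ)

IsMITL-FP : {Σ' : Set} → FPForm Σ' → Set
IsMITL-FP (atom _) = ⊤
IsMITL-FP (φ ∧' ψ) = IsMITL-FP φ × IsMITL-FP ψ
IsMITL-FP (¬' φ) = IsMITL-FP φ
IsMITL-FP (F[ I ] φ) = (¬ Singular I) × IsMITL-FP φ
IsMITL-FP (P[ I ] φ) = (¬ Singular I) × IsMITL-FP φ

{-# OPTIONS --safe #-}
-- A bounded formula ψ only inspects timestamps up to its horizon (the sum of the
-- upper ends of its nested U-intervals) beyond the current one, so from the first
-- position it cannot tell apart two words whose timestamps agree below horizon ψ + 1.
-- The MITL[F,P] formula φ = F_[0,∞) (¬ P_[0,2) ⊤ ∧ P_[0,∞) P_[0,∞) ⊤) asks for a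
-- position with at least two predecessors, none of them at distance less than 2.
-- On the words with timestamps 0, A, A + c it holds iff c ≥ 2; for A = horizon ψ
-- the words with c = 2 and c = 1 agree below A + 1, yet only the first satisfies φ.
module Submission where

open import Defs hiding (sym)
open import Data.Nat using (ℕ; suc; z≤n; s≤s)
open import Data.Fin using (Fin; zero) renaming (_<_ to _<ᶠ_; _≤_ to _≤ᶠ_)
open import Data.Fin.Patterns using (0F; 1F; 2F)
open import Data.Rational using (ℚ; 0ℚ; _+_; _-_; _⊔_; _≤_; _<_)
import Data.Rational.Properties as ℚ
import Data.Nat.Properties as ℕ
open import Algebra.Properties.AbelianGroup ℚ.+-0-abelianGroup using (xyx⁻¹≈y; //-rightDividesˡ)
open import Data.Product using (Σ; _×_; _,_; proj₁; proj₂)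
open import Data.Sum using (_⊎_; inj₁; inj₂; swap)
open import Data.Unit using (tt)
open import Data.Empty using (⊥-elim)
open import Data.Bool using (true; false)
open import Relation.Nullary using (¬_)
open import Relation.Nullary.Decidable using (from-yes)
open import Relation.Binary.PropositionalEquality using (_≡_; refl; sym; subst; subst₂)

≤⇒≯ : ∀ {p q} → p ≤ q → ¬ q < p
≤⇒≯ p≤q q<p = ℚ.<-irrefl refl (ℚ.<-≤-trans q<p p≤q)

ℕ→ℚ-nonNeg : ∀ n → 0ℚ ≤ ℕ→ℚ n
ℕ→ℚ-nonNeg n = ℚ.nonNegative⁻¹ (ℕ→ℚ n) {{ℚ.normalize-nonNeg n 1}}

p≤p+q : ∀ p {q} → 0ℚ ≤ q → p ≤ p + q
p≤p+q p {q} 0≤q = subst (_≤ p + q) (ℚ.+-identityʳ p) (ℚ.+-monoʳ-≤ p 0≤q)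

p≤q+p : ∀ p {q} → 0ℚ ≤ q → p ≤ q + p
p≤q+p p {q} 0≤q = subst (_≤ q + p) (ℚ.+-identityˡ p) (ℚ.+-monoˡ-≤ p 0≤q)

-≤⇒≤+ : ∀ {x y d} → x - y ≤ d → x ≤ y + d
-≤⇒≤+ {x} {y} {d} x-y≤d = begin
  x          ≡⟨ sym (//-rightDividesˡ y x) ⟩
  (x - y) + y ≤⟨ ℚ.+-monoˡ-≤ y x-y≤d ⟩
  d + y      ≡⟨ ℚ.+-comm d y ⟩
  y + d      ∎
  where open ℚ.≤-Reasoning

+-weakenʳ-< : ∀ t {h h' M} → h ≤ h' → t + h' < M → t + h < M
+-weakenʳ-< t h≤h' = ℚ.≤-<-trans (ℚ.+-monoʳ-≤ t h≤h')

+-weakenˡ-< : ∀ {t t' h M} → t' ≤ t → t + h < M → t' + h < M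
+-weakenˡ-< {h = h} t'≤t = ℚ.≤-<-trans (ℚ.+-monoˡ-≤ h t'≤t)

+-dropʳ-< : ∀ {t h M} → 0ℚ ≤ h → t + h < M → t < M
+-dropʳ-< {t} 0≤h = ℚ.≤-<-trans (p≤p+q t 0≤h)

-- The value at ∞ is junk; it is only used for bounded intervals.
upperEnd : Interval → ℚ
upperEnd ⟨ _ , _ , fin h _ ⟩ = ℕ→ℚ h
upperEnd ⟨ _ , _ , ∞ ⟩ = 0ℚ

upperEnd-nonNeg : ∀ I → 0ℚ ≤ upperEnd I
upperEnd-nonNeg ⟨ _ , _ , fin h _ ⟩ = ℕ→ℚ-nonNeg h
upperEnd-nonNeg ⟨ _ , _ , ∞ ⟩ = ℚ.≤-refl

∈I⇒≤upperEnd : ∀ {d} I → Bounded I → d ∈I I → d ≤ upperEnd I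
∈I⇒≤upperEnd ⟨ _ , true , fin _ true ⟩ _ (_ , d≤h) = d≤h
∈I⇒≤upperEnd ⟨ _ , true , fin _ false ⟩ _ (_ , d<h) = ℚ.<⇒≤ d<h
∈I⇒≤upperEnd ⟨ _ , false , fin _ true ⟩ _ (_ , d≤h) = d≤h
∈I⇒≤upperEnd ⟨ _ , false , fin _ false ⟩ _ (_ , d<h) = ℚ.<⇒≤ d<h

horizon : {Σ' : Set} → Form Σ' → ℚ
horizon (atom _) = 0ℚ
horizon (φ ∧' ψ) = horizon φ ⊔ horizon ψ
horizon (¬' φ) = horizon φ
horizon (U[ I ] φ ψ) = upperEnd I + (horizon φ ⊔ horizon ψ)
horizon (S[ I ] φ ψ) = horizon φ ⊔ horizon ψ

⊔-nonNeg : ∀ {p q} → 0ℚ ≤ p → 0ℚ ≤ q → 0ℚ ≤ p ⊔ q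
⊔-nonNeg {p} {q} 0≤p _ = ℚ.≤-trans 0≤p (ℚ.p≤p⊔q p q)

horizon-nonNeg : {Σ' : Set} (ψ : Form Σ') → 0ℚ ≤ horizon ψ
horizon-nonNeg (atom _) = ℚ.≤-refl
horizon-nonNeg (φ ∧' ψ) = ⊔-nonNeg (horizon-nonNeg φ) (horizon-nonNeg ψ)
horizon-nonNeg (¬' φ) = horizon-nonNeg φ
horizon-nonNeg (U[ I ] φ ψ) =
  ℚ.≤-trans (upperEnd-nonNeg I) (p≤p+q (upperEnd I) (⊔-nonNeg (horizon-nonNeg φ) (horizon-nonNeg ψ)))
horizon-nonNeg (S[ I ] φ ψ) = ⊔-nonNeg (horizon-nonNeg φ) (horizon-nonNeg ψ)

record Timing (n : ℕ) : Set where
  field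
    stamp      : Fin (suc n) → ℚ
    stamp-zero : stamp zero ≡ 0ℚ
    stamp-mono : ∀ i j → i ≤ᶠ j → stamp i ≤ stamp j

open Timing

word : {Σ' : Set} {n : ℕ} → (Fin (suc n) → Σ') → Timing n → TimedWord Σ'
word {n = n} s T = record
  { len = n ; sym = s ; time = stamp T ; time-zero = stamp-zero T ; time-mono = stamp-mono T }

-- Symmetric because negation swaps the two words.
AgreeBelow : {m : ℕ} → ℚ → (Fin m → ℚ) → (Fin m → ℚ) → Set
AgreeBelow M t t' = ∀ p → t p < M ⊎ t' p < M → t p ≡ t' p

agreeBelow-sym : ∀ {m M} {t t' : Fin m → ℚ} → AgreeBelow M t t' → AgreeBelow M t' t
agreeBelow-sym agree p below = sym (agree p (swap below))

module _ {Σ' : Set} {n : ℕ} (s : Fin (suc n) → Σ') {M : ℚ} where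

  ⊨-transport : ∀ T T' (ψ : Form Σ') → IsBMTL ψ → AgreeBelow M (stamp T) (stamp T') →
    ∀ i → stamp T i + horizon ψ < M → word s T , i ⊨ ψ → word s T' , i ⊨ ψ
  ⊨-transport _ _ (atom _) _ _ _ _ sat = sat
  ⊨-transport T T' (φ ∧' ψ) (bφ , bψ) agree i fits (satφ , satψ) =
    ⊨-transport T T' φ bφ agree i (+-weakenʳ-< (stamp T i) (ℚ.p≤p⊔q (horizon φ) (horizon ψ)) fits) satφ ,
    ⊨-transport T T' ψ bψ agree i (+-weakenʳ-< (stamp T i) (ℚ.p≤q⊔p (horizon φ) (horizon ψ)) fits) satψ
  ⊨-transport T T' (¬' φ) bφ agree i fits unsat sat' =
    unsat (⊨-transport T' T φ bφ (agreeBelow-sym agree) i fits' sat')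
    where
    fits' : stamp T' i + horizon φ < M
    fits' = subst (λ x → x + horizon φ < M)
                  (agree i (inj₁ (+-dropʳ-< (horizon-nonNeg φ) fits))) fits
  ⊨-transport T T' (U[ I ] φ ψ) (bI , bφ , bψ) agree i fits (j , i<j , satψ , dist , between) =
    j , i<j , ⊨-transport T T' ψ bψ agree j (reachψ j ℕ.≤-refl) satψ ,
    subst₂ (λ x y → (x - y) ∈I I) (agree j (inj₁ tj<M)) (agree i (inj₁ ti<M)) dist ,
    λ k i<k k<j → ⊨-transport T T' φ bφ agree k (reachφ k (ℕ.<⇒≤ k<j)) (between k i<k k<j)
    where
    t = stamp T
    h = horizon φ ⊔ horizon ψ
    reach : ∀ k → k ≤ᶠ j → t k + h < M
    reach k k≤j = +-weakenˡ-< tk≤ (subst (_< M) (sym (ℚ.+-assoc (t i) (upperEnd I) h)) fits)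
      where
      tk≤ : t k ≤ t i + upperEnd I
      tk≤ = ℚ.≤-trans (stamp-mono T k j k≤j) (-≤⇒≤+ (∈I⇒≤upperEnd I bI dist))
    reachφ : ∀ k → k ≤ᶠ j → t k + horizon φ < M
    reachφ k k≤j = +-weakenʳ-< (t k) (ℚ.p≤p⊔q (horizon φ) (horizon ψ)) (reach k k≤j)
    reachψ : ∀ k → k ≤ᶠ j → t k + horizon ψ < M
    reachψ k k≤j = +-weakenʳ-< (t k) (ℚ.p≤q⊔p (horizon φ) (horizon ψ)) (reach k k≤j)
    ti<M : t i < M
    ti<M = +-dropʳ-< (horizon-nonNeg (U[ I ] φ ψ)) fits
    tj<M : t j < M
    tj<M = +-dropʳ-< (horizon-nonNeg ψ) (reachψ j ℕ.≤-refl)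
  ⊨-transport T T' (S[ I ] φ ψ) (_ , bφ , bψ) agree i fits (j , j<i , satψ , dist , between) =
    j , j<i , ⊨-transport T T' ψ bψ agree j (reachψ j (ℕ.<⇒≤ j<i)) satψ ,
    subst₂ (λ x y → (x - y) ∈I I) (agree i (inj₁ ti<M)) (agree j (inj₁ tj<M)) dist ,
    λ k j<k k<i → ⊨-transport T T' φ bφ agree k (reachφ k (ℕ.<⇒≤ k<i)) (between k j<k k<i)
    where
    t = stamp T
    reachφ : ∀ k → k ≤ᶠ i → t k + horizon φ < M
    reachφ k k≤i = +-weakenˡ-< (stamp-mono T k i k≤i)
                     (+-weakenʳ-< (t i) (ℚ.p≤p⊔q (horizon φ) (horizon ψ)) fits)
    reachψ : ∀ k → k ≤ᶠ i → t k + horizon ψ < M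
    reachψ k k≤i = +-weakenˡ-< (stamp-mono T k i k≤i)
                     (+-weakenʳ-< (t i) (ℚ.p≤q⊔p (horizon φ) (horizon ψ)) fits)
    ti<M : t i < M
    ti<M = +-dropʳ-< (horizon-nonNeg (S[ I ] φ ψ)) fits
    tj<M : t j < M
    tj<M = +-dropʳ-< (horizon-nonNeg ψ) (reachψ j (ℕ.<⇒≤ j<i))

module Witness {Σ' : Set} (a : Σ') where

  ⊤ᶠ : FPForm Σ'
  ⊤ᶠ = ¬' (atom a ∧' (¬' atom a))

  atLeast0 : Interval
  atLeast0 = ⟨ 0 , true , ∞ ⟩

  below2 : Interval
  below2 = ⟨ 0 , true , fin 2 false ⟩

  φ : FPForm Σ'
  φ = F[ atLeast0 ] ((¬' P[ below2 ] ⊤ᶠ) ∧' P[ atLeast0 ] (P[ atLeast0 ] ⊤ᶠ))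

  φ-MITL : IsMITL-FP φ
  φ-MITL = (λ ()) , ((λ ()) , tt , tt) , (λ ()) , (λ ()) , tt , tt

  ⊨⊤ : (ρ : TimedWord Σ') → ∀ i → ρ , i ⊨ top a
  ⊨⊤ ρ i (isA , notA) = notA isA

  module _ {A : ℚ} (0≤A : 0ℚ ≤ A) where

    gapTiming : ∀ c → 0ℚ ≤ c → Timing 2
    gapTiming c 0≤c = record { stamp = t ; stamp-zero = refl ; stamp-mono = mono }
      where
      t : Fin 3 → ℚ
      t 0F = 0ℚ
      t 1F = A
      t 2F = A + c
      mono : ∀ i j → i ≤ᶠ j → t i ≤ t j
      mono 0F 0F _ = ℚ.≤-refl
      mono 0F 1F _ = 0≤A
      mono 0F 2F _ = ℚ.≤-trans 0≤A (p≤p+q A 0≤c)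
      mono 1F 1F _ = ℚ.≤-refl
      mono 1F 2F _ = p≤p+q A 0≤c
      mono 2F 2F _ = ℚ.≤-refl
      mono 1F 0F ()
      mono 2F 0F ()
      mono 2F 1F (s≤s ())

    gapWord : ∀ c → 0ℚ ≤ c → TimedWord Σ'
    gapWord c 0≤c = word (λ _ → a) (gapTiming c 0≤c)

    gapWord-⊨φ : ∀ {c} (0≤c : 0ℚ ≤ c) → ℕ→ℚ 2 ≤ c → gapWord c 0≤c , 0F ⊨ toForm a φ
    gapWord-⊨φ {c} 0≤c 2≤c =
      2F , s≤s z≤n , (noRecent , twoBefore) ,
      (subst (0ℚ ≤_) (sym (ℚ.+-identityʳ (A + c))) (ℚ.≤-trans 0≤A (p≤p+q A 0≤c)) , tt) ,
      λ k _ _ → ⊨⊤ ρ k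
      where
      ρ = gapWord c 0≤c
      noRecent : ¬ (ρ , 2F ⊨ S[ below2 ] (top a) (top a))
      noRecent (0F , _ , _ , (_ , d<2) , _) =
        ≤⇒≯ (ℚ.≤-trans 2≤c (p≤q+p c 0≤A)) (subst (_< ℕ→ℚ 2) (ℚ.+-identityʳ (A + c)) d<2)
      noRecent (1F , _ , _ , (_ , d<2) , _) = ≤⇒≯ 2≤c (subst (_< ℕ→ℚ 2) (xyx⁻¹≈y A c) d<2)
      noRecent (2F , s≤s (s≤s ()) , _)
      twoBefore : ρ , 2F ⊨ S[ atLeast0 ] (top a) (S[ atLeast0 ] (top a) (top a))
      twoBefore =
        1F , s≤s (s≤s z≤n) ,
        (0F , s≤s z≤n , ⊨⊤ ρ 0F , (subst (0ℚ ≤_) (sym (ℚ.+-identityʳ A)) 0≤A , tt) ,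
          λ { 0F () _ ; 1F _ (s≤s ()) }) ,
        (subst (0ℚ ≤_) (sym (xyx⁻¹≈y A c)) 0≤c , tt) ,
        λ { 0F () _ ; 1F (s≤s ()) _ ; 2F _ (s≤s (s≤s ())) }

    gapWord-⊭φ : ∀ {c} (0≤c : 0ℚ ≤ c) → c < ℕ→ℚ 2 → ¬ (gapWord c 0≤c , 0F ⊨ toForm a φ)
    gapWord-⊭φ 0≤c c<2 (0F , () , _)
    gapWord-⊭φ 0≤c c<2 (1F , _ , (_ , 0F , _ , (_ , () , _) , _) , _)
    gapWord-⊭φ 0≤c c<2 (1F , _ , (_ , 1F , s≤s () , _) , _)
    gapWord-⊭φ 0≤c c<2 (2F , _ , (noRecent , _) , _) =
      noRecent (1F , s≤s (s≤s z≤n) , ⊨⊤ (gapWord _ 0≤c) 1F ,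
        (subst (0ℚ ≤_) (sym (xyx⁻¹≈y A _)) 0≤c , subst (_< ℕ→ℚ 2) (sym (xyx⁻¹≈y A _)) c<2) ,
        λ { 0F () _ ; 1F (s≤s ()) _ ; 2F _ (s≤s (s≤s ())) })

  φ-not-BMTL-definable : (ψ : Form Σ') → IsBMTL ψ → ¬ SameLanguage ψ (toForm a φ)
  φ-not-BMTL-definable ψ bψ same = gapWord-⊭φ 0≤A 0≤1 1<2 (proj₁ (same (word _ near)) ψ-near)
    where
    A = horizon ψ
    0≤A = horizon-nonNeg ψ
    0≤1 = ℕ→ℚ-nonNeg 1
    0≤2 = ℕ→ℚ-nonNeg 2
    1<2 : ℕ→ℚ 1 < ℕ→ℚ 2
    1<2 = from-yes (ℕ→ℚ 1 ℚ.<? ℕ→ℚ 2)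
    far = gapTiming 0≤A (ℕ→ℚ 2) 0≤2
    near = gapTiming 0≤A (ℕ→ℚ 1) 0≤1
    agree : AgreeBelow (A + ℕ→ℚ 1) (stamp far) (stamp near)
    agree 0F _ = refl
    agree 1F _ = refl
    agree 2F (inj₁ A+2<A+1) = ⊥-elim (≤⇒≯ (ℚ.+-monoʳ-≤ A (ℚ.<⇒≤ 1<2)) A+2<A+1)
    agree 2F (inj₂ A+1<A+1) = ⊥-elim (ℚ.<-irrefl refl A+1<A+1)
    fits : 0ℚ + A < A + ℕ→ℚ 1
    fits = subst (_< A + ℕ→ℚ 1) (ℚ.+-comm A 0ℚ) (ℚ.+-monoʳ-< A (from-yes (0ℚ ℚ.<? ℕ→ℚ 1)))
    ψ-far : word _ far , 0F ⊨ ψ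
    ψ-far = proj₂ (same (word _ far)) (gapWord-⊨φ 0≤A 0≤2 ℚ.≤-refl)
    ψ-near : word _ near , 0F ⊨ ψ
    ψ-near = ⊨-transport (λ _ → a) far near ψ bψ agree 0F fits ψ-far

theorem2 : (k : ℕ) → Σ (FPForm (Fin (suc k))) λ φ → IsMITL-FP φ
    × ((ψ : Form (Fin (suc k))) → IsBMTL ψ → ¬ SameLanguage ψ (toForm zero φ))
theorem2 k = φ , φ-MITL , φ-not-BMTL-definable
  where open Witness (zero {k})
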